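{- Let $a$ be a complex number which is not a non-positive integer, and let $n,\lambda\in\mathbb Z_{\ge0}$. Put \[ B_{n,\lambda}(z)=\sum_{i=0}^n\binom ni\frac{(-1)^i z^{n-i}}{(a)_{i+\lambda}} . \] Then $\deg_z B_{n,\lambda}=n$, and there is a polynomial $A_{n,\lambda}(z)$ with $\deg_z A_{n,\lambda}\le n+\lambda-1$ such that, as formal power series in $z$, \[ B_{n,\lambda}(z)\,{}_2F_0(a,1\mid z)-A_{n,\lambda}(z)=L_{n,\lambda}(z), \] where $\operatorname{ord}_{z=0}L_{n,\lambda}(z)=2n+\lambda$ and explicitly \[ L_{n,\lambda}(z)=(-1)^n n!\,z^{2n+\lambda}\sum_{k=0}^\infty k!\binom{n+k}{k}\binom{n+k+a+\lambda-1}{k}z^k . \]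
   Context: The Pochhammer symbol is defined by $(a)_0=1$ and $(a)_{k+1}=(a+k)(a)_k$ for $k\in\mathbb Z_{\ge0}$. The formal hypergeometric series is ${}_2F_0(a,1\mid z)=\sum_{k=0}^\infty (a)_k z^k$. For non-integer upper entry, $\binom{x}{k}=x(x-1)\cdots(x-k+1)/k!$, so that $\binom{n+k+a+\lambda-1}{k}=(n+a+\lambda)_k/k!$. $\operatorname{ord}_{z=0}$ of a formal power series is the smallest exponent with a nonzero coefficient. -}

module Defs where

open import Level using (_⊔_)
open import Data.Nat as ℕ using (ℕ; zero; suc; _∸_; _≤?_; _≟_)
open import Data.Nat.Combinatorics using (_C_)
open import Data.Product using (Σ; _×_)
open import Relation.Nullary using (¬_; yes; no)
open import Algebra.Bundles using (CommutativeRing)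

record Field (c ℓ : Level.Level) : Set (Level.suc (c ⊔ ℓ)) where
  field
    commRing : CommutativeRing c ℓ
  open CommutativeRing commRing public
  field
    inv      : Carrier → Carrier
    inverseʳ : ∀ x → ¬ (x ≈ 0#) → (x * inv x) ≈ 1#
    nontrivial : ¬ (1# ≈ 0#)

module FieldDefs {c ℓ} (F : Field c ℓ) where
  open Field F using (Carrier; _≈_; _+_; _*_; _-_; -_; 0#; 1#; inv)
    public

  fromℕ : ℕ → Carrier
  fromℕ zero    = 0#
  fromℕ (suc n) = 1# + fromℕ n

  CharZero : Set ℓ
  CharZero = ∀ n → ¬ (fromℕ (suc n) ≈ 0#)

  pow : Carrier → ℕ → Carrier
  pow x zero    = 1#
  pow x (suc k) = x * pow x k

  poch : Carrier → ℕ → Carrier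
  poch a zero    = 1#
  poch a (suc k) = (a + fromℕ k) * poch a k

  fact : ℕ → Carrier
  fact zero    = 1#
  fact (suc k) = fromℕ (suc k) * fact k

  falling : Carrier → ℕ → Carrier
  falling x zero    = 1#
  falling x (suc k) = (x - fromℕ k) * falling x k

  gbinom : Carrier → ℕ → Carrier
  gbinom x k = falling x k * inv (fact k)

  Series : Set c
  Series = ℕ → Carrier

  sumTo : ℕ → (ℕ → Carrier) → Carrier
  sumTo zero    f = f zero
  sumTo (suc n) f = sumTo n f + f (suc n)

  monomial : Carrier → ℕ → Series
  monomial x e j with j ≟ e
  ... | yes _ = x
  ... | no  _ = 0#

  seriesSum : ℕ → (ℕ → Series) → Series
  seriesSum n s j = sumTo n (λ i → s i j)

  _⋆_ : Series → Series → Series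
  (f ⋆ g) m = sumTo m (λ i → f i * g (m ∸ i))

  _⊖_ : Series → Series → Series
  (f ⊖ g) m = f m - g m

  -- formal 2F0(a,1 | z) = Σ_k (a)_k z^k
  F20 : Carrier → Series
  F20 a k = poch a k

  HasDegree : Series → ℕ → Set ℓ
  HasDegree p d = ¬ (p d ≈ 0#) × (∀ j → d ℕ.< j → p j ≈ 0#)

  -- degree ≤ m - 1, i.e. all coefficients of z^j with j ≥ m vanish
  -- (for m = 0 this says p = 0, i.e. deg p ≤ -1)
  DegreeBelow : Series → ℕ → Set ℓ
  DegreeBelow p m = ∀ j → m ℕ.≤ j → p j ≈ 0#

  HasOrder : Series → ℕ → Set ℓ
  HasOrder f d = ¬ (f d ≈ 0#) × (∀ j → j ℕ.< d → f j ≈ 0#)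

  B : Carrier → ℕ → ℕ → Series
  B a n l = seriesSum n (λ i →
      monomial (fromℕ (n C i) * pow (- 1#) i * inv (poch a (i ℕ.+ l))) (n ∸ i))

  Lcoef : Carrier → ℕ → ℕ → ℕ → Carrier
  Lcoef a n l k =
    pow (- 1#) n * fact n * (fact k * fromℕ ((n ℕ.+ k) C k)
      * gbinom (fromℕ (n ℕ.+ k ℕ.+ l) + a - 1#) k)

  L : Carrier → ℕ → ℕ → Series
  L a n l j with (2 ℕ.* n ℕ.+ l) ℕ.≤? j
  ... | yes _ = Lcoef a n l (j ∸ (2 ℕ.* n ℕ.+ l))
  ... | no  _ = 0#

-- Write Δ n f = Σᵢ C(n,i) (−1)ⁱ f(i), i.e. (−1)ⁿ times the n-th forward difference of f at 0.
-- Since (a)_{i+λ+s} = (a+λ+i)_s (a)_{i+λ}, the coefficient of z^{n+λ+s} in B·₂F₀ is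
-- Δ n (i ↦ (a+λ+i)_s). The forward difference lowers the degree of the polynomial
-- i ↦ (x+i)_s by one, so this vanishes for s < n, while for s = n+k the recursion
-- Δ (n+1) f = Δ n f − Δ n (f ∘ suc) together with (y)_{k+1} − (y+1)_{k+1} = −(k+1)(y+1)_k
-- evaluates it to (−1)ⁿ n! C(n+k,k) (a+λ+n)_k, which is the coefficient of L.
-- Taking for A the part of B·₂F₀ of degree below n+λ gives the theorem.
module Submission where

open import Defs
open import Data.Nat as ℕ using (ℕ; zero; suc; _∸_; _!; _<?_; z≤n)
import Data.Nat.Properties as ℕₚ
open import Data.Nat.Combinatorics
  using (_C_; nCk≡n!/k![n-k]!; k![n∸k]!∣n!; nCn≡1; k>n⇒nCk≡0; nCk+nC[k+1]≡[n+1]C[k+1])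
open import Data.Nat.DivMod using (m/n*n≡m)
open import Data.Nat.Tactic.RingSolver using (solve-∀)
open import Data.Product using (Σ; _×_; _,_)
open import Data.Sum using (inj₁; inj₂)
open import Relation.Nullary using (¬_; yes; no)
open import Relation.Binary.PropositionalEquality as ≡ using (_≡_; _≢_)
open import Function using (_∘_)
open import Data.Empty using (⊥-elim)

[m+k]Ck*[k!*m!]≡[m+k]! : ∀ m k → ((m ℕ.+ k) C k) ℕ.* (k ! ℕ.* m !) ≡ (m ℕ.+ k) !
[m+k]Ck*[k!*m!]≡[m+k]! m k = begin
  ((m ℕ.+ k) C k) ℕ.* (k ! ℕ.* m !)
    ≡⟨ ≡.cong (λ t → ((m ℕ.+ k) C k) ℕ.* (k ! ℕ.* t !)) (≡.sym (ℕₚ.m+n∸n≡m m k)) ⟩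
  ((m ℕ.+ k) C k) ℕ.* d              ≡⟨ ≡.cong (ℕ._* d) (nCk≡n!/k![n-k]! k≤m+k) ⟩
  (m ℕ.+ k) ! ℕ./ d ℕ.* d            ≡⟨ m/n*n≡m (k![n∸k]!∣n! k≤m+k) ⟩
  (m ℕ.+ k) !                        ∎
  where
  open ≡.≡-Reasoning
  k≤m+k : k ℕ.≤ m ℕ.+ k
  k≤m+k = ℕₚ.m≤n+m k m
  d : ℕ
  d = k ! ℕ.* (m ℕ.+ k ∸ k) !
  instance
    d≢0 : ℕ.NonZero d
    d≢0 = k ℕₚ.!* (m ℕ.+ k ∸ k) !≢0

[1+k]*[n+[1+k]]C[1+k]≡[1+n]*[1+n+k]Ck :
  ∀ n k → suc k ℕ.* ((n ℕ.+ suc k) C suc k) ≡ suc n ℕ.* ((suc n ℕ.+ k) C k)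
[1+k]*[n+[1+k]]C[1+k]≡[1+n]*[1+n+k]Ck n k =
  ℕₚ.*-cancelʳ-≡ _ _ (k ! ℕ.* n !) {{k ℕₚ.!* n !≢0}} (begin
    suc k ℕ.* C₁ ℕ.* (k ! ℕ.* n !)  ≡⟨ regroup k C₁ (k !) (n !) ⟩
    C₁ ℕ.* (suc k ! ℕ.* n !)        ≡⟨ [m+k]Ck*[k!*m!]≡[m+k]! n (suc k) ⟩
    (n ℕ.+ suc k) !                 ≡⟨ ≡.cong _! (ℕₚ.+-suc n k) ⟩
    (suc n ℕ.+ k) !                 ≡⟨ [m+k]Ck*[k!*m!]≡[m+k]! (suc n) k ⟨
    C₂ ℕ.* (k ! ℕ.* suc n !)        ≡⟨ regroup′ n C₂ (k !) (n !) ⟩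
    suc n ℕ.* C₂ ℕ.* (k ! ℕ.* n !)  ∎)
  where
  open ≡.≡-Reasoning
  C₁ C₂ : ℕ
  C₁ = (n ℕ.+ suc k) C suc k
  C₂ = (suc n ℕ.+ k) C k
  regroup : ∀ k c f g → suc k ℕ.* c ℕ.* (f ℕ.* g) ≡ c ℕ.* (suc k ℕ.* f ℕ.* g)
  regroup = solve-∀
  regroup′ : ∀ n c f g → c ℕ.* (f ℕ.* (suc n ℕ.* g)) ≡ suc n ℕ.* c ℕ.* (f ℕ.* g)
  regroup′ = solve-∀

m+n+m≡2*m+n : ∀ m n → m ℕ.+ n ℕ.+ m ≡ 2 ℕ.* m ℕ.+ n
m+n+m≡2*m+n = solve-∀

[n+m]∸[n∸i]≡i+m : ∀ {i n} m → i ℕ.≤ n → n ℕ.+ m ∸ (n ∸ i) ≡ i ℕ.+ m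
[n+m]∸[n∸i]≡i+m {i} {n} m i≤n = begin
  n ℕ.+ m ∸ (n ∸ i)                ≡⟨ ≡.cong (λ t → t ℕ.+ m ∸ (n ∸ i)) (ℕₚ.m∸n+n≡m i≤n) ⟨
  n ∸ i ℕ.+ i ℕ.+ m ∸ (n ∸ i)      ≡⟨ ≡.cong (_∸ (n ∸ i)) (ℕₚ.+-assoc (n ∸ i) i m) ⟩
  n ∸ i ℕ.+ (i ℕ.+ m) ∸ (n ∸ i)    ≡⟨ ℕₚ.m+n∸m≡n (n ∸ i) (i ℕ.+ m) ⟩
  i ℕ.+ m                          ∎
  where open ≡.≡-Reasoning

module _ {c ℓ} (F : Field c ℓ) where
  open FieldDefs F
  open Field F using (commutativeSemiring; ring; setoid; refl; sym; trans; reflexive;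
    +-cong; *-cong; inverseʳ; nontrivial; +-identityˡ; +-identityʳ; *-identityʳ;
    zeroˡ; zeroʳ; -‿cong; -‿inverseʳ; +-comm; *-comm; +-assoc; distribˡ; distribʳ)
  open import Algebra.Properties.Ring ring using (-1*x≈-x; -‿involutive; -0#≈0#)
  open import Algebra.Solver.Ring.NaturalCoefficients.Default commutativeSemiring
  open import Relation.Binary.Reasoning.Setoid setoid

  fromℕ-+ : ∀ m k → fromℕ (m ℕ.+ k) ≈ fromℕ m + fromℕ k
  fromℕ-+ zero    k = sym (+-identityˡ _)
  fromℕ-+ (suc m) k = trans (+-cong refl (fromℕ-+ m k)) (sym (+-assoc _ _ _))

  fromℕ-* : ∀ m k → fromℕ (m ℕ.* k) ≈ fromℕ m * fromℕ k
  fromℕ-* zero    k = sym (zeroˡ _)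
  fromℕ-* (suc m) k = trans (fromℕ-+ k (m ℕ.* k)) (trans (+-cong refl (fromℕ-* m k))
    (solve 2 (λ K M → K :+ M :* K := (con 1 :+ M) :* K) refl (fromℕ k) (fromℕ m)))

  x+-1*x≈0 : ∀ x → x + - 1# * x ≈ 0#
  x+-1*x≈0 x = trans (+-cong refl (-1*x≈-x x)) (-‿inverseʳ x)

  *-nonzero : ∀ {x y} → ¬ x ≈ 0# → ¬ y ≈ 0# → ¬ x * y ≈ 0#
  *-nonzero {x} {y} x≉0 y≉0 xy≈0 = nontrivial (begin
    1#                         ≈⟨ sym (inverseʳ x x≉0) ⟩
    x * inv x                  ≈⟨ sym (*-identityʳ _) ⟩
    (x * inv x) * 1#           ≈⟨ *-cong refl (sym (inverseʳ y y≉0)) ⟩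
    (x * inv x) * (y * inv y)  ≈⟨ solve 4 (λ X X' Y Y' → (X :* X') :* (Y :* Y') := (X :* Y) :* (X' :* Y'))
                                    refl x (inv x) y (inv y) ⟩
    (x * y) * (inv x * inv y)  ≈⟨ *-cong xy≈0 refl ⟩
    0# * (inv x * inv y)       ≈⟨ zeroˡ _ ⟩
    0#                         ∎)

  inv-nonzero : ∀ {x} → ¬ x ≈ 0# → ¬ inv x ≈ 0#
  inv-nonzero {x} x≉0 x⁻¹≈0 =
    nontrivial (trans (sym (inverseʳ x x≉0)) (trans (*-cong refl x⁻¹≈0) (zeroʳ x)))

  inverseˡ : ∀ x → ¬ x ≈ 0# → inv x * x ≈ 1#
  inverseˡ x x≉0 = trans (*-comm _ _) (inverseʳ x x≉0)

  -1-nonzero : ¬ - 1# ≈ 0#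
  -1-nonzero -1≈0 = nontrivial (begin
    1#       ≈⟨ sym (-‿involutive 1#) ⟩
    - (- 1#) ≈⟨ -‿cong -1≈0 ⟩
    - 0#     ≈⟨ -0#≈0# ⟩
    0#       ∎)

  pow-nonzero : ∀ {x} → ¬ x ≈ 0# → ∀ k → ¬ pow x k ≈ 0#
  pow-nonzero x≉0 zero    = nontrivial
  pow-nonzero x≉0 (suc k) = *-nonzero x≉0 (pow-nonzero x≉0 k)

  fact-nonzero : CharZero → ∀ k → ¬ fact k ≈ 0#
  fact-nonzero char0 zero    = nontrivial
  fact-nonzero char0 (suc k) = *-nonzero (char0 k) (fact-nonzero char0 k)

  poch-nonzero : ∀ {a} → (∀ k → ¬ a + fromℕ k ≈ 0#) → ∀ k → ¬ poch a k ≈ 0#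
  poch-nonzero a+k≉0 zero    = nontrivial
  poch-nonzero a+k≉0 (suc k) = *-nonzero (a+k≉0 k) (poch-nonzero a+k≉0 k)

  sumTo-cong : ∀ n {f g} → (∀ i → i ℕ.≤ n → f i ≈ g i) → sumTo n f ≈ sumTo n g
  sumTo-cong zero    f≈g = f≈g 0 z≤n
  sumTo-cong (suc n) f≈g =
    +-cong (sumTo-cong n (λ i i≤n → f≈g i (ℕₚ.m≤n⇒m≤1+n i≤n))) (f≈g (suc n) ℕₚ.≤-refl)

  sumTo-zero : ∀ n {f} → (∀ i → i ℕ.≤ n → f i ≈ 0#) → sumTo n f ≈ 0#
  sumTo-zero zero    f≈0 = f≈0 0 z≤n
  sumTo-zero (suc n) f≈0 = trans
    (+-cong (sumTo-zero n (λ i i≤n → f≈0 i (ℕₚ.m≤n⇒m≤1+n i≤n))) (f≈0 (suc n) ℕₚ.≤-refl))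
    (+-identityˡ 0#)

  sumTo-+ : ∀ n f g → sumTo n (λ i → f i + g i) ≈ sumTo n f + sumTo n g
  sumTo-+ zero    f g = refl
  sumTo-+ (suc n) f g = trans (+-cong (sumTo-+ n f g) refl)
    (solve 4 (λ A B X Y → (A :+ B) :+ (X :+ Y) := (A :+ X) :+ (B :+ Y)) refl _ _ _ _)

  sumTo-*ˡ : ∀ n x f → sumTo n (λ i → x * f i) ≈ x * sumTo n f
  sumTo-*ˡ zero    x f = refl
  sumTo-*ˡ (suc n) x f = trans (+-cong (sumTo-*ˡ n x f) refl) (sym (distribˡ x _ _))

  sumTo-suc : ∀ n f → sumTo (suc n) f ≈ f 0 + sumTo n (λ i → f (suc i))
  sumTo-suc zero    f = refl
  sumTo-suc (suc n) f = trans (+-cong (sumTo-suc n f) refl) (+-assoc _ _ _)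

  sumTo-single : ∀ m e {f} → e ℕ.≤ m → (∀ i → i ℕ.≤ m → i ≢ e → f i ≈ 0#) → sumTo m f ≈ f e
  sumTo-single zero    zero    z≤n   f≈0 = refl
  sumTo-single (suc m) e       e≤1+m f≈0 with e ℕ.≟ suc m
  ... | yes ≡.refl = trans
    (+-cong (sumTo-zero m (λ i i≤m → f≈0 i (ℕₚ.m≤n⇒m≤1+n i≤m) (ℕₚ.<⇒≢ (ℕ.s≤s i≤m)))) refl)
    (+-identityˡ _)
  ... | no e≢1+m = trans
    (+-cong (sumTo-single m e (ℕₚ.≤-pred (ℕₚ.≤∧≢⇒< e≤1+m e≢1+m))
                              (λ i i≤m → f≈0 i (ℕₚ.m≤n⇒m≤1+n i≤m)))
            (f≈0 (suc m) ℕₚ.≤-refl (e≢1+m ∘ ≡.sym)))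
    (+-identityʳ _)

  monomial-≡ : ∀ x e → monomial x e e ≈ x
  monomial-≡ x e with e ℕ.≟ e
  ... | yes _   = refl
  ... | no e≢e = ⊥-elim (e≢e ≡.refl)

  monomial-≢ : ∀ x e {j} → j ≢ e → monomial x e j ≈ 0#
  monomial-≢ x e {j} j≢e with j ℕ.≟ e
  ... | yes j≡e = ⊥-elim (j≢e j≡e)
  ... | no _    = refl

  monomial-⋆ : ∀ x e g {m} → e ℕ.≤ m → (monomial x e ⋆ g) m ≈ x * g (m ∸ e)
  monomial-⋆ x e g {m} e≤m = trans
    (sumTo-single m e e≤m (λ i _ i≢e → trans (*-cong (monomial-≢ x e i≢e) refl) (zeroˡ _)))
    (*-cong (monomial-≡ x e) refl)

  seriesSum-⋆ : ∀ n s g m → (seriesSum n s ⋆ g) m ≈ sumTo n (λ i → (s i ⋆ g) m)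
  seriesSum-⋆ zero    s g m = refl
  seriesSum-⋆ (suc n) s g m = begin
    sumTo m (λ p → (seriesSum n s p + s (suc n) p) * g (m ∸ p))
      ≈⟨ sumTo-cong m (λ p _ → distribʳ _ _ _) ⟩
    sumTo m (λ p → seriesSum n s p * g (m ∸ p) + s (suc n) p * g (m ∸ p))
      ≈⟨ sumTo-+ m _ _ ⟩
    (seriesSum n s ⋆ g) m + (s (suc n) ⋆ g) m
      ≈⟨ +-cong (seriesSum-⋆ n s g m) refl ⟩
    sumTo (suc n) (λ i → (s i ⋆ g) m) ∎

  truncate : ℕ → Series → Series
  truncate m f j with m ℕ.≤? j
  ... | yes _ = 0#
  ... | no _  = f j

  truncate-degreeBelow : ∀ m f → DegreeBelow (truncate m f) m
  truncate-degreeBelow m f j m≤j with m ℕ.≤? j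
  ... | yes _   = refl
  ... | no m≰j = ⊥-elim (m≰j m≤j)

  ⊖-truncate-below : ∀ m f {j} → j ℕ.< m → (f ⊖ truncate m f) j ≈ 0#
  ⊖-truncate-below m f {j} j<m with m ℕ.≤? j
  ... | yes m≤j = ⊥-elim (ℕₚ.<⇒≱ j<m m≤j)
  ... | no _    = -‿inverseʳ (f j)

  ⊖-truncate-from : ∀ m f {j} → m ℕ.≤ j → (f ⊖ truncate m f) j ≈ f j
  ⊖-truncate-from m f {j} m≤j with m ℕ.≤? j
  ... | yes _   = trans (+-cong refl -0#≈0#) (+-identityʳ (f j))
  ... | no m≰j = ⊥-elim (m≰j m≤j)

  poch-cong : ∀ {x y} k → x ≈ y → poch x k ≈ poch y k
  poch-cong zero    x≈y = refl
  poch-cong (suc k) x≈y = *-cong (+-cong x≈y refl) (poch-cong k x≈y)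

  poch-suc : ∀ y k → poch y (suc k) ≈ y * poch (y + 1#) k
  poch-suc y zero    = *-cong (+-identityʳ y) refl
  poch-suc y (suc k) = begin
    (y + fromℕ (suc k)) * poch y (suc k)          ≈⟨ *-cong refl (poch-suc y k) ⟩
    (y + (1# + fromℕ k)) * (y * poch (y + 1#) k)
      ≈⟨ solve 4 (λ Y U K Q → (Y :+ (U :+ K)) :* (Y :* Q) := Y :* (((Y :+ U) :+ K) :* Q))
           refl y 1# (fromℕ k) _ ⟩
    y * (((y + 1#) + fromℕ k) * poch (y + 1#) k)  ∎

  poch-+ : ∀ x p s → poch x (p ℕ.+ s) ≈ poch (x + fromℕ p) s * poch x p
  poch-+ x zero    s = trans (poch-cong s (sym (+-identityʳ x))) (sym (*-identityʳ _))
  poch-+ x (suc p) s = begin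
    poch x (suc p ℕ.+ s)                                  ≈⟨ poch-suc x (p ℕ.+ s) ⟩
    x * poch (x + 1#) (p ℕ.+ s)                           ≈⟨ *-cong refl (poch-+ (x + 1#) p s) ⟩
    x * (poch (x + 1# + fromℕ p) s * poch (x + 1#) p)
      ≈⟨ *-cong refl (*-cong (poch-cong s (+-assoc _ _ _)) refl) ⟩
    x * (poch (x + fromℕ (suc p)) s * poch (x + 1#) p)
      ≈⟨ solve 3 (λ X A B → X :* (A :* B) := A :* (X :* B)) refl x _ _ ⟩
    poch (x + fromℕ (suc p)) s * (x * poch (x + 1#) p)    ≈⟨ *-cong refl (sym (poch-suc x p)) ⟩
    poch (x + fromℕ (suc p)) s * poch x (suc p)           ∎

  poch-suc-difference : ∀ y k →
    poch y (suc k) + - 1# * poch (y + 1#) (suc k) ≈ - 1# * (fromℕ (suc k) * poch (y + 1#) k)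
  poch-suc-difference y k = begin
    poch y (suc k) + - 1# * (((y + 1#) + K) * Q)   ≈⟨ +-cong (poch-suc y k) refl ⟩
    y * Q + - 1# * (((y + 1#) + K) * Q)
      ≈⟨ solve 5 (λ Y Q U K M → Y :* Q :+ M :* (((Y :+ U) :+ K) :* Q)
                               := (Y :+ M :* Y) :* Q :+ M :* ((U :+ K) :* Q)) refl y Q 1# K (- 1#) ⟩
    (y + - 1# * y) * Q + - 1# * ((1# + K) * Q)     ≈⟨ +-cong (*-cong (x+-1*x≈0 y) refl) refl ⟩
    0# * Q + - 1# * ((1# + K) * Q)                 ≈⟨ trans (+-cong (zeroˡ Q) refl) (+-identityˡ _) ⟩
    - 1# * ((1# + K) * Q)                          ∎
    where
    K Q : Carrier
    K = fromℕ k
    Q = poch (y + 1#) k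

  falling≈poch : ∀ k {y z} → z ≈ y + fromℕ k - 1# → falling z k ≈ poch y k
  falling≈poch zero    z≈ = refl
  falling≈poch (suc k) {y} {z} z≈ = begin
    (z - fromℕ k) * falling z k  ≈⟨ *-cong z-k≈y (falling≈poch k z≈′) ⟩
    y * poch (y + 1#) k          ≈⟨ poch-suc y k ⟨
    poch y (suc k)               ∎
    where
    K : Carrier
    K = fromℕ k
    z≈′ : z ≈ (y + 1#) + K - 1#
    z≈′ = trans z≈ (solve 4 (λ Y U K M → Y :+ (U :+ K) :+ M := Y :+ U :+ K :+ M) refl y 1# K (- 1#))
    z-k≈y : z - K ≈ y
    z-k≈y = begin
      z + - K                              ≈⟨ +-cong z≈ refl ⟩
      y + (1# + K) + - 1# + - K
        ≈⟨ solve 5 (λ Y U K M N → Y :+ (U :+ K) :+ M :+ N := Y :+ (U :+ M) :+ (K :+ N))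
             refl y 1# K (- 1#) (- K) ⟩
      y + (1# + - 1#) + (K + - K)          ≈⟨ +-cong (+-cong refl (-‿inverseʳ 1#)) (-‿inverseʳ K) ⟩
      y + 0# + 0#                          ≈⟨ trans (+-identityʳ _) (+-identityʳ y) ⟩
      y                                    ∎

  Δ : ℕ → (ℕ → Carrier) → Carrier
  Δ n f = sumTo n (λ i → fromℕ (n C i) * pow (- 1#) i * f i)

  Δ-suc : ∀ n f → Δ (suc n) f ≈ Δ n f + - 1# * Δ n (λ i → f (suc i))
  Δ-suc n f = begin
    Δ (suc n) f
      ≈⟨ sumTo-suc n _ ⟩
    t 0 + sumTo n (λ i → fromℕ (suc n C suc i) * pow (- 1#) (suc i) * f (suc i))
      ≈⟨ +-cong refl (sumTo-cong n (λ i _ → pascal i)) ⟩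
    t 0 + sumTo n (λ i → - 1# * (fromℕ (n C i) * pow (- 1#) i * f (suc i)) + t (suc i))
      ≈⟨ +-cong refl (trans (sumTo-+ n _ _) (+-cong (sumTo-*ˡ n (- 1#) _) refl)) ⟩
    t 0 + (- 1# * Δ′ + sumTo n (λ i → t (suc i)))
      ≈⟨ solve 3 (λ A B C → A :+ (B :+ C) := B :+ (A :+ C)) refl (t 0) (- 1# * Δ′) _ ⟩
    - 1# * Δ′ + (t 0 + sumTo n (λ i → t (suc i)))
      ≈⟨ +-cong refl (sym (sumTo-suc n t)) ⟩
    - 1# * Δ′ + (Δ n f + t (suc n))
      ≈⟨ +-cong refl (trans (+-cong refl top-vanishes) (+-identityʳ _)) ⟩
    - 1# * Δ′ + Δ n f
      ≈⟨ +-comm _ _ ⟩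
    Δ n f + - 1# * Δ′ ∎
    where
    t : ℕ → Carrier
    t i = fromℕ (n C i) * pow (- 1#) i * f i
    Δ′ : Carrier
    Δ′ = Δ n (λ i → f (suc i))
    top-vanishes : t (suc n) ≈ 0#
    top-vanishes = trans
      (*-cong (*-cong (reflexive (≡.cong fromℕ (k>n⇒nCk≡0 (ℕₚ.n<1+n n)))) refl) refl)
      (trans (*-cong (zeroˡ _) refl) (zeroˡ _))
    pascal : ∀ i → fromℕ (suc n C suc i) * pow (- 1#) (suc i) * f (suc i)
                 ≈ - 1# * (fromℕ (n C i) * pow (- 1#) i * f (suc i)) + t (suc i)
    pascal i = trans
      (*-cong (*-cong (trans (reflexive (≡.cong fromℕ (≡.sym (nCk+nC[k+1]≡[n+1]C[k+1] n i))))
                             (fromℕ-+ (n C i) (n C suc i))) refl) refl)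
      (solve 5 (λ A B M Q X → (A :+ B) :* (M :* Q) :* X := M :* (A :* Q :* X) :+ B :* (M :* Q) :* X)
         refl (fromℕ (n C i)) (fromℕ (n C suc i)) (- 1#) (pow (- 1#) i) (f (suc i)))

  Δ-suc-poch : ∀ n x s → Δ (suc n) (λ i → poch (x + fromℕ i) s)
    ≈ Δ n (λ i → poch (x + fromℕ i) s) + - 1# * Δ n (λ i → poch (x + 1# + fromℕ i) s)
  Δ-suc-poch n x s = trans (Δ-suc n _) (+-cong refl (*-cong refl (sumTo-cong n (λ i _ →
    *-cong refl (poch-cong s (sym (+-assoc x 1# (fromℕ i))))))))

  Δ-poch : ∀ n x k → Δ n (λ i → poch (x + fromℕ i) (n ℕ.+ k))
    ≈ pow (- 1#) n * fact n * fromℕ ((n ℕ.+ k) C k) * poch (x + fromℕ n) k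
  Δ-poch zero x k = begin
    (1# + 0#) * 1# * poch (x + 0#) k
      ≈⟨ solve 1 (λ Q → (con 1 :+ con 0) :* con 1 :* Q := con 1 :* con 1 :* (con 1 :+ con 0) :* Q) refl _ ⟩
    1# * 1# * fromℕ 1 * poch (x + 0#) k
      ≈⟨ *-cong (*-cong refl (reflexive (≡.cong fromℕ (≡.sym (nCn≡1 k))))) refl ⟩
    1# * 1# * fromℕ (k C k) * poch (x + 0#) k    ∎
  Δ-poch (suc n) x k = begin
    Δ (suc n) (λ i → poch (x + fromℕ i) (suc n ℕ.+ k))
      ≡⟨ ≡.cong (λ s → Δ (suc n) (λ i → poch (x + fromℕ i) s)) (≡.sym (ℕₚ.+-suc n k)) ⟩
    Δ (suc n) (λ i → poch (x + fromℕ i) (n ℕ.+ suc k))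
      ≈⟨ Δ-suc-poch n x (n ℕ.+ suc k) ⟩
    Δ n (λ i → poch (x + fromℕ i) (n ℕ.+ suc k))
      + - 1# * Δ n (λ i → poch (x + 1# + fromℕ i) (n ℕ.+ suc k))
      ≈⟨ +-cong (Δ-poch n x (suc k)) (*-cong refl (Δ-poch n (x + 1#) (suc k))) ⟩
    W * poch y (suc k) + - 1# * (W * poch (x + 1# + fromℕ n) (suc k))
      ≈⟨ +-cong refl (*-cong refl (*-cong refl (poch-cong (suc k) x+1+n≈y+1))) ⟩
    W * poch y (suc k) + - 1# * (W * poch (y + 1#) (suc k))
      ≈⟨ solve 4 (λ W A B M → W :* A :+ M :* (W :* B) := W :* (A :+ M :* B)) refl W _ _ (- 1#) ⟩
    W * (poch y (suc k) + - 1# * poch (y + 1#) (suc k))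
      ≈⟨ *-cong refl (poch-suc-difference y k) ⟩
    W * (- 1# * (fromℕ (suc k) * Q))
      ≈⟨ solve 6 (λ S F C Q K M → S :* F :* C :* (M :* (K :* Q)) := M :* S :* F :* Q :* (K :* C))
           refl (pow (- 1#) n) (fact n) C₁ Q (fromℕ (suc k)) (- 1#) ⟩
    - 1# * pow (- 1#) n * fact n * Q * (fromℕ (suc k) * C₁)
      ≈⟨ *-cong refl absorption ⟩
    - 1# * pow (- 1#) n * fact n * Q * (fromℕ (suc n) * C₂)
      ≈⟨ solve 6 (λ S F C Q N M → M :* S :* F :* Q :* (N :* C) := M :* S :* (N :* F) :* C :* Q)
           refl (pow (- 1#) n) (fact n) C₂ Q (fromℕ (suc n)) (- 1#) ⟩
    pow (- 1#) (suc n) * fact (suc n) * C₂ * Q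
      ≈⟨ *-cong refl (poch-cong k y+1≈x+[1+n]) ⟩
    pow (- 1#) (suc n) * fact (suc n) * C₂ * poch (x + fromℕ (suc n)) k ∎
    where
    y C₁ C₂ W Q : Carrier
    y  = x + fromℕ n
    C₁ = fromℕ ((n ℕ.+ suc k) C suc k)
    C₂ = fromℕ ((suc n ℕ.+ k) C k)
    W  = pow (- 1#) n * fact n * C₁
    Q  = poch (y + 1#) k
    x+1+n≈y+1 : x + 1# + fromℕ n ≈ y + 1#
    x+1+n≈y+1 = solve 3 (λ X U N → X :+ U :+ N := X :+ N :+ U) refl x 1# (fromℕ n)
    y+1≈x+[1+n] : y + 1# ≈ x + fromℕ (suc n)
    y+1≈x+[1+n] = solve 3 (λ X U N → X :+ N :+ U := X :+ (U :+ N)) refl x 1# (fromℕ n)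
    absorption : fromℕ (suc k) * C₁ ≈ fromℕ (suc n) * C₂
    absorption = begin
      fromℕ (suc k) * C₁                          ≈⟨ fromℕ-* (suc k) ((n ℕ.+ suc k) C suc k) ⟨
      fromℕ (suc k ℕ.* ((n ℕ.+ suc k) C suc k))
        ≡⟨ ≡.cong fromℕ ([1+k]*[n+[1+k]]C[1+k]≡[1+n]*[1+n+k]Ck n k) ⟩
      fromℕ (suc n ℕ.* ((suc n ℕ.+ k) C k))       ≈⟨ fromℕ-* (suc n) ((suc n ℕ.+ k) C k) ⟩
      fromℕ (suc n) * C₂                          ∎

  Δ-poch-vanishes : ∀ {n s} → s ℕ.< n → ∀ x → Δ n (λ i → poch (x + fromℕ i) s) ≈ 0#
  Δ-poch-vanishes {suc n} {s} s<1+n x with ℕₚ.m<1+n⇒m<n∨m≡n s<1+n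
  ... | inj₁ s<n = begin
    Δ (suc n) (λ i → poch (x + fromℕ i) s)
      ≈⟨ Δ-suc-poch n x s ⟩
    Δ n (λ i → poch (x + fromℕ i) s) + - 1# * Δ n (λ i → poch (x + 1# + fromℕ i) s)
      ≈⟨ +-cong (Δ-poch-vanishes s<n x) (*-cong refl (Δ-poch-vanishes s<n (x + 1#))) ⟩
    0# + - 1# * 0#
      ≈⟨ trans (+-identityˡ _) (zeroʳ _) ⟩
    0# ∎
  ... | inj₂ ≡.refl = begin
    Δ (suc n) (λ i → poch (x + fromℕ i) n)
      ≡⟨ ≡.cong (λ s → Δ (suc n) (λ i → poch (x + fromℕ i) s)) (≡.sym (ℕₚ.+-identityʳ n)) ⟩
    Δ (suc n) (λ i → poch (x + fromℕ i) (n ℕ.+ 0))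
      ≈⟨ Δ-suc-poch n x (n ℕ.+ 0) ⟩
    Δ n (λ i → poch (x + fromℕ i) (n ℕ.+ 0)) + - 1# * Δ n (λ i → poch (x + 1# + fromℕ i) (n ℕ.+ 0))
      ≈⟨ +-cong (Δ-poch n x 0) (*-cong refl (Δ-poch n (x + 1#) 0)) ⟩
    w + - 1# * w
      ≈⟨ x+-1*x≈0 w ⟩
    0# ∎
    where
    w : Carrier
    w = pow (- 1#) n * fact n * fromℕ ((n ℕ.+ 0) C 0) * 1#

  L-below : ∀ a n l {j} → j ℕ.< 2 ℕ.* n ℕ.+ l → L a n l j ≈ 0#
  L-below a n l {j} j<2n+l with (2 ℕ.* n ℕ.+ l) ℕ.≤? j
  ... | yes 2n+l≤j = ⊥-elim (ℕₚ.<⇒≱ j<2n+l 2n+l≤j)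
  ... | no _       = refl

  L-from : ∀ a n l k → L a n l (2 ℕ.* n ℕ.+ l ℕ.+ k) ≈ Lcoef a n l k
  L-from a n l k with (2 ℕ.* n ℕ.+ l) ℕ.≤? (2 ℕ.* n ℕ.+ l ℕ.+ k)
  ... | yes _   = reflexive (≡.cong (Lcoef a n l) (ℕₚ.m+n∸m≡n (2 ℕ.* n ℕ.+ l) k))
  ... | no 2n+l≰ = ⊥-elim (2n+l≰ (ℕₚ.m≤m+n (2 ℕ.* n ℕ.+ l) k))

  Lcoef≈poch : CharZero → ∀ a n l k →
    Lcoef a n l k ≈ pow (- 1#) n * fact n * fromℕ ((n ℕ.+ k) C k) * poch (a + fromℕ l + fromℕ n) k
  Lcoef≈poch char0 a n l k = begin
    S * fact n * (fact k * Cₙₖ * (falling z k * inv (fact k)))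
      ≈⟨ *-cong refl (*-cong refl (*-cong (falling≈poch k z≈) refl)) ⟩
    S * fact n * (fact k * Cₙₖ * (P * inv (fact k)))
      ≈⟨ solve 6 (λ S F G C P G' → S :* F :* (G :* C :* (P :* G')) := S :* F :* C :* P :* (G :* G'))
           refl S (fact n) (fact k) Cₙₖ P (inv (fact k)) ⟩
    S * fact n * Cₙₖ * P * (fact k * inv (fact k))
      ≈⟨ trans (*-cong refl (inverseʳ (fact k) (fact-nonzero char0 k))) (*-identityʳ _) ⟩
    S * fact n * Cₙₖ * P ∎
    where
    S Cₙₖ P z : Carrier
    S = pow (- 1#) n
    Cₙₖ = fromℕ ((n ℕ.+ k) C k)
    P = poch (a + fromℕ l + fromℕ n) k
    z = fromℕ (n ℕ.+ k ℕ.+ l) + a - 1#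
    z≈ : z ≈ a + fromℕ l + fromℕ n + fromℕ k - 1#
    z≈ = trans (+-cong (+-cong (trans (fromℕ-+ (n ℕ.+ k) l) (+-cong (fromℕ-+ n k) refl)) refl) refl)
      (solve 5 (λ N K L A M → N :+ K :+ L :+ A :+ M := A :+ L :+ N :+ K :+ M)
         refl (fromℕ n) (fromℕ k) (fromℕ l) a (- 1#))

  module _ (char0 : CharZero) (a : Carrier) (a+k≉0 : ∀ k → ¬ a + fromℕ k ≈ 0#) (n l : ℕ) where

    Bcoef : ℕ → Carrier
    Bcoef i = fromℕ (n C i) * pow (- 1#) i * inv (poch a (i ℕ.+ l))

    B⋆F : Series
    B⋆F = B a n l ⋆ F20 a

    B-hasDegree : HasDegree (B a n l) n
    B-hasDegree = (λ Bₙ≈0 → Bcoef₀≉0 (trans (sym Bₙ≈Bcoef₀) Bₙ≈0)) , B-vanishes-above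
      where
      Bcoef₀≉0 : ¬ Bcoef 0 ≈ 0#
      Bcoef₀≉0 = *-nonzero (*-nonzero (char0 0) nontrivial) (inv-nonzero (poch-nonzero a+k≉0 l))
      Bₙ≈Bcoef₀ : B a n l n ≈ Bcoef 0
      Bₙ≈Bcoef₀ = trans
        (sumTo-single n 0 z≤n (λ i i≤n i≢0 → monomial-≢ (Bcoef i) (n ∸ i)
          (λ n≡n∸i → ℕₚ.<⇒≢ (ℕₚ.∸-monoʳ-< (ℕₚ.n≢0⇒n>0 i≢0) i≤n) (≡.sym n≡n∸i))))
        (monomial-≡ (Bcoef 0) n)
      B-vanishes-above : ∀ j → n ℕ.< j → B a n l j ≈ 0#
      B-vanishes-above j n<j = sumTo-zero n (λ i _ → monomial-≢ (Bcoef i) (n ∸ i)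
        (λ j≡n∸i → ℕₚ.<⇒≢ (ℕₚ.≤-<-trans (ℕₚ.m∸n≤m n i) n<j) (≡.sym j≡n∸i)))

    B⋆F-coefficient : ∀ s → B⋆F (n ℕ.+ l ℕ.+ s) ≈ Δ n (λ i → poch (a + fromℕ l + fromℕ i) s)
    B⋆F-coefficient s = trans
      (seriesSum-⋆ n (λ i → monomial (Bcoef i) (n ∸ i)) (F20 a) (n ℕ.+ l ℕ.+ s))
      (sumTo-cong n term)
      where
      term : ∀ i → i ℕ.≤ n → (monomial (Bcoef i) (n ∸ i) ⋆ F20 a) (n ℕ.+ l ℕ.+ s)
                            ≈ fromℕ (n C i) * pow (- 1#) i * poch (a + fromℕ l + fromℕ i) s
      term i i≤n = begin
        (monomial (Bcoef i) (n ∸ i) ⋆ F20 a) (n ℕ.+ l ℕ.+ s)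
          ≈⟨ monomial-⋆ (Bcoef i) (n ∸ i) (F20 a) n∸i≤n+l+s ⟩
        Bcoef i * poch a (n ℕ.+ l ℕ.+ s ∸ (n ∸ i))
          ≡⟨ ≡.cong (λ t → Bcoef i * poch a t) index ⟩
        Bcoef i * poch a (i ℕ.+ l ℕ.+ s)
          ≈⟨ *-cong refl (poch-+ a (i ℕ.+ l) s) ⟩
        Bcoef i * (poch (a + fromℕ (i ℕ.+ l)) s * P)
          ≈⟨ solve 5 (λ C S P' Q P → C :* S :* P' :* (Q :* P) := C :* S :* Q :* (P' :* P))
               refl (fromℕ (n C i)) (pow (- 1#) i) (inv P) (poch (a + fromℕ (i ℕ.+ l)) s) P ⟩
        fromℕ (n C i) * pow (- 1#) i * poch (a + fromℕ (i ℕ.+ l)) s * (inv P * P)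
          ≈⟨ trans (*-cong refl (inverseˡ P (poch-nonzero a+k≉0 (i ℕ.+ l)))) (*-identityʳ _) ⟩
        fromℕ (n C i) * pow (- 1#) i * poch (a + fromℕ (i ℕ.+ l)) s
          ≈⟨ *-cong refl (poch-cong s (trans (+-cong refl (fromℕ-+ i l))
               (solve 3 (λ A I L → A :+ (I :+ L) := A :+ L :+ I) refl a (fromℕ i) (fromℕ l)))) ⟩
        fromℕ (n C i) * pow (- 1#) i * poch (a + fromℕ l + fromℕ i) s ∎
        where
        P : Carrier
        P = poch a (i ℕ.+ l)
        n∸i≤n+l+s : n ∸ i ℕ.≤ n ℕ.+ l ℕ.+ s
        n∸i≤n+l+s = ℕₚ.≤-trans (ℕₚ.m∸n≤m n i) (ℕₚ.≤-trans (ℕₚ.m≤m+n n l) (ℕₚ.m≤m+n (n ℕ.+ l) s))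
        index : n ℕ.+ l ℕ.+ s ∸ (n ∸ i) ≡ i ℕ.+ l ℕ.+ s
        index = ≡.trans (≡.cong (_∸ (n ∸ i)) (ℕₚ.+-assoc n l s))
                  (≡.trans ([n+m]∸[n∸i]≡i+m (l ℕ.+ s) i≤n) (≡.sym (ℕₚ.+-assoc i l s)))

    B⋆F≈L : ∀ s → B⋆F (n ℕ.+ l ℕ.+ s) ≈ L a n l (n ℕ.+ l ℕ.+ s)
    B⋆F≈L s with s <? n
    ... | yes s<n = begin
      B⋆F (n ℕ.+ l ℕ.+ s)                            ≈⟨ B⋆F-coefficient s ⟩
      Δ n (λ i → poch (a + fromℕ l + fromℕ i) s)     ≈⟨ Δ-poch-vanishes s<n (a + fromℕ l) ⟩
      0#                                             ≈⟨ L-below a n l n+l+s<2n+l ⟨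
      L a n l (n ℕ.+ l ℕ.+ s)                        ∎
      where
      n+l+s<2n+l : n ℕ.+ l ℕ.+ s ℕ.< 2 ℕ.* n ℕ.+ l
      n+l+s<2n+l = ≡.subst (n ℕ.+ l ℕ.+ s ℕ.<_) (m+n+m≡2*m+n n l) (ℕₚ.+-monoʳ-< (n ℕ.+ l) s<n)
    ... | no s≮n with ℕₚ.m≤n⇒∃[o]m+o≡n (ℕₚ.≮⇒≥ s≮n)
    ...   | k , ≡.refl = begin
      B⋆F (n ℕ.+ l ℕ.+ (n ℕ.+ k))                              ≈⟨ B⋆F-coefficient (n ℕ.+ k) ⟩
      Δ n (λ i → poch (a + fromℕ l + fromℕ i) (n ℕ.+ k))       ≈⟨ Δ-poch n (a + fromℕ l) k ⟩
      pow (- 1#) n * fact n * fromℕ ((n ℕ.+ k) C k) * poch (a + fromℕ l + fromℕ n) k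
                                                               ≈⟨ Lcoef≈poch char0 a n l k ⟨
      Lcoef a n l k                                            ≈⟨ L-from a n l k ⟨
      L a n l (2 ℕ.* n ℕ.+ l ℕ.+ k)                            ≡⟨ ≡.cong (L a n l) reindex ⟩
      L a n l (n ℕ.+ l ℕ.+ (n ℕ.+ k))                          ∎
      where
      reindex : 2 ℕ.* n ℕ.+ l ℕ.+ k ≡ n ℕ.+ l ℕ.+ (n ℕ.+ k)
      reindex = ≡.trans (≡.cong (ℕ._+ k) (≡.sym (m+n+m≡2*m+n n l))) (ℕₚ.+-assoc (n ℕ.+ l) n k)

    remainder≈L : ∀ j → (B⋆F ⊖ truncate (n ℕ.+ l) B⋆F) j ≈ L a n l j
    remainder≈L j with ℕₚ.<-≤-connex j (n ℕ.+ l)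
    ... | inj₁ j<n+l = trans (⊖-truncate-below (n ℕ.+ l) B⋆F j<n+l) (sym (L-below a n l j<2n+l))
      where
      j<2n+l : j ℕ.< 2 ℕ.* n ℕ.+ l
      j<2n+l = ℕₚ.<-≤-trans j<n+l (≡.subst (n ℕ.+ l ℕ.≤_) (m+n+m≡2*m+n n l) (ℕₚ.m≤m+n (n ℕ.+ l) n))
    ... | inj₂ n+l≤j with ℕₚ.m≤n⇒∃[o]m+o≡n n+l≤j
    ...   | s , ≡.refl = trans (⊖-truncate-from (n ℕ.+ l) B⋆F n+l≤j) (B⋆F≈L s)

    L-hasOrder : HasOrder (L a n l) (2 ℕ.* n ℕ.+ l)
    L-hasOrder = L[2n+l]≉0 , λ j j<2n+l → L-below a n l j<2n+l
      where
      leading : Carrier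
      leading = pow (- 1#) n * fact n * fromℕ ((n ℕ.+ 0) C 0) * 1#
      L[2n+l]≉0 : ¬ L a n l (2 ℕ.* n ℕ.+ l) ≈ 0#
      L[2n+l]≉0 L≈0 = leading≉0 (begin
        leading                            ≈⟨ Lcoef≈poch char0 a n l 0 ⟨
        Lcoef a n l 0                      ≈⟨ L-from a n l 0 ⟨
        L a n l (2 ℕ.* n ℕ.+ l ℕ.+ 0)      ≡⟨ ≡.cong (L a n l) (ℕₚ.+-identityʳ _) ⟩
        L a n l (2 ℕ.* n ℕ.+ l)            ≈⟨ L≈0 ⟩
        0#                                 ∎)
        where
        leading≉0 : ¬ leading ≈ 0#
        leading≉0 = *-nonzero
          (*-nonzero (*-nonzero (pow-nonzero -1-nonzero n) (fact-nonzero char0 n)) (char0 0))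
          nontrivial

theorem2 : ∀ {c ℓ} (F : Field c ℓ) → let open FieldDefs F in
    CharZero → (a : Carrier) → (∀ k → ¬ (a + fromℕ k ≈ 0#)) → (n l : ℕ) →
    HasDegree (B a n l) n ×
    Σ Series (λ A → DegreeBelow A (n ℕ.+ l) ×
      (∀ j → ((B a n l ⋆ F20 a) ⊖ A) j ≈ L a n l j) ×
      HasOrder (L a n l) (2 ℕ.* n ℕ.+ l))
theorem2 F char0 a a+k≉0 n l =
  B-hasDegree F char0 a a+k≉0 n l ,
  truncate F (n ℕ.+ l) (B⋆F F char0 a a+k≉0 n l) ,
  truncate-degreeBelow F (n ℕ.+ l) _ ,
  remainder≈L F char0 a a+k≉0 n l ,
  L-hasOrder F char0 a a+k≉0 n l
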